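{- Let $G_1, \dots, G_m$ be finite simple connected graphs with $n_i = |V(G_i)|$, and let $G$ be their Cartesian product, so $n = |V(G)| = n_1 n_2 \cdots n_m$. Then $c_{\infty}(G) \le \dfrac{n\, c_{\infty}(G_1)}{n_1}$.
   Context: The Cartesian product of $G_1,\dots,G_m$ has vertex set $V(G_1)\times\cdots\times V(G_m)$, with $(u_1,\dots,u_m)$ adjacent to $(v_1,\dots,v_m)$ iff there is an index $j$ with $u_i = v_i$ for all $i \neq j$ and $u_j v_j \in E(G_j)$. Cops and Robber game with a fast robber: the cops first choose initial vertices (several may share a vertex), then the robber chooses a vertex. Players alternate rounds, cops first. Each cop stays or moves to an adjacent vertex; the robber may stay or move along any path from her current vertex containing no vertex occupied by a cop. The cops win if a cop moves onto the robber's vertex; the robber wins if she evades forever. $c_{\infty}(G)$ is the minimum number of cops guaranteeing a cop win. -}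

module Defs where

open import Data.Nat using (ℕ; _<_; _≤_)
open import Data.Fin using (Fin)
open import Data.Product using (Σ; ∃; _×_)
open import Data.Sum using (_⊎_)
open import Data.Unit using (⊤)
open import Data.Empty using (⊥)
open import Data.List using (List; []; _∷_; foldr; map)
open import Data.Nat.ListAction using (product)
open import Relation.Nullary using (¬_)
open import Relation.Binary.PropositionalEquality using (_≡_)
open import Relation.Binary.Construct.Closure.ReflexiveTransitive using (Star)

record Graph : Set₁ where
  field
    V : Set
    E : V → V → Set
open Graph public

record FinGraph : Set₁ where
  field
    size   : ℕ
    Adj    : Fin size → Fin size → Set
    sym    : ∀ {u v} → Adj u v → Adj v u
    irrefl : ∀ {u} → ¬ Adj u u
open FinGraph public

toGraph : FinGraph → Graph
toGraph G = record { V = Fin (size G) ; E = Adj G }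

Connected : FinGraph → Set
Connected G = (0 < size G) × (∀ (u v : Fin (size G)) → Star (Adj G) u v)

_□_ : Graph → Graph → Graph
G □ H = record
  { V = V G × V H
  ; E = λ { (a Data.Product., b) (c Data.Product., d) →
            (E G a c × b ≡ d) ⊎ (a ≡ c × E H b d) } }

K₁ : Graph
K₁ = record { V = ⊤ ; E = λ _ _ → ⊥ }

-- Cartesian product G₁ □ (G₂ □ (... □ (Gₘ □ K₁))); its vertex set is
-- Fin n₁ × (Fin n₂ × ... × (Fin nₘ × ⊤)) ≅ V(G₁) × ... × V(Gₘ).
CartesianProduct : List FinGraph → Graph
CartesianProduct Gs = foldr _□_ K₁ (map toGraph Gs)

productSize : List FinGraph → ℕ
productSize Gs = product (map size Gs)

-- Cops and Robber with a fast robber, k cops on graph G.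

module Game (G : Graph) (k : ℕ) where

  Config : Set
  Config = Fin k → V G

  CopStep : Config → Config → Set
  CopStep C C' = ∀ (c : Fin k) → (C' c ≡ C c) ⊎ E G (C c) (C' c)

  Occupied : Config → V G → Set
  Occupied C v = ∃ λ (c : Fin k) → C c ≡ v

  FreePath : Config → V G → V G → Set
  FreePath C r r' =
    ¬ Occupied C r × Star (λ x y → E G x y × ¬ Occupied C y) r r'

  -- CopWin C r : it is the cops' turn, cops at C, robber at r, and the
  -- cops can force capture in finitely many rounds against any robber.
  data CopWin (C : Config) (r : V G) : Set where
    move : (C' : Config) → CopStep C C' →
           (Occupied C' r ⊎ (∀ r' → FreePath C' r r' → CopWin C' r')) →
           CopWin C r

  -- the cops choose initial vertices, then the robber chooses a vertex,
  -- then the cops move first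
  CopsWin : Set
  CopsWin = Σ Config λ C → ∀ (r : V G) → CopWin C r

CopsWin : Graph → ℕ → Set
CopsWin G k = Game.CopsWin G k

IsCopNumber : Graph → ℕ → Set
IsCopNumber G k = CopsWin G k × (∀ j → CopsWin G j → k ≤ j)

module Submission where

-- Let G = G₁ □ H with H = G₂ □ ⋯ □ Gₘ, and let N = n₂ ⋯ nₘ be
-- the number of vertices of H.  Take a winning strategy for k₁ cops on G₁
-- and place one copy of it in every layer G₁ × {w}, w ∈ V(H): k₁ · N cops
-- in total.  The robber's projection onto G₁ is a legal robber in G₁, since
-- a step inside an H-fibre does not move the projection, and a step along
-- G₁ avoiding the cops of the product avoids the cops of G₁ (every G₁-cop
-- has a shadow in every layer).  When the G₁-strategy catches the projected
-- robber, the shadow in the robber's layer catches the robber itself.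
-- Hence c∞(G) ≤ k₁ · N, and multiplying by n₁ gives the claim.

open import Defs
open import Data.Nat using (ℕ; _*_; _≤_)
open import Data.Nat.Properties using (*-monoˡ-≤; *-comm; *-assoc)
open import Data.List using (List; _∷_; [])
open import Data.List.Relation.Unary.All using (All)
open import Data.Fin using (Fin; combine; remQuot; zero)
open import Data.Fin.Properties using (remQuot-combine)
open import Data.Product using (_×_; _,_; proj₁; proj₂)
open import Data.Sum using (inj₁; inj₂)
open import Data.Unit using (tt)
open import Relation.Nullary using (¬_)
open import Relation.Binary.PropositionalEquality
  using (_≡_; refl; trans; cong; subst; module ≡-Reasoning)
open import Relation.Binary.Construct.Closure.ReflexiveTransitive
  using (Star; ε; _◅_)

-- An enumeration of the vertices of H by Fin N: a split surjection
-- Fin N → V H.  Only its existence matters: it lets N cops be indexed by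
-- the vertices of H.
record Enumeration (H : Graph) (N : ℕ) : Set where
  field
    code        : V H → Fin N
    decode      : Fin N → V H
    decode-code : ∀ w → decode (code w) ≡ w

decode-pair : ∀ {m n} {A : Set} (d : Fin n → A) (i : Fin m) (j : Fin n) →
  (λ p → proj₁ p , d (proj₂ p)) (remQuot n (combine i j)) ≡ (i , d j)
decode-pair {n = n} d i j = cong (λ p → proj₁ p , d (proj₂ p)) (remQuot-combine {k = n} i j)

productEnumeration : (Gs : List FinGraph) →
  Enumeration (CartesianProduct Gs) (productSize Gs)
productEnumeration [] = record
  { code = λ _ → zero ; decode = λ _ → tt ; decode-code = λ _ → refl }
productEnumeration (G ∷ Gs) = record
  { code        = λ { (a , w) → combine a (code w) }
  ; decode      = λ i → let p = remQuot (productSize Gs) i in proj₁ p , decode (proj₂ p)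
  ; decode-code = λ { (a , w) →
      trans (decode-pair decode a (code w)) (cong (a ,_) (decode-code w)) }
  }
  where open Enumeration (productEnumeration Gs)

module Layered (A H : Graph) (k N : ℕ) (enum : Enumeration H N) where
  open Enumeration enum

  module GA = Game A k
  module GP = Game (A □ H) (k * N)

  -- Cop number c of the product plays "cop i of A, in layer w".
  cop : Fin (k * N) → Fin k × V H
  cop c = let p = remQuot N c in proj₁ p , decode (proj₂ p)

  copIndex : Fin k × V H → Fin (k * N)
  copIndex (i , w) = combine i (code w)

  cop-copIndex : ∀ p → cop (copIndex p) ≡ p
  cop-copIndex (i , w) = trans (decode-pair decode i (code w)) (cong (i ,_) (decode-code w))

  layered : GA.Config → GP.Config
  layered D c = D (proj₁ (cop c)) , proj₂ (cop c)

  layered-occupied : ∀ D {x} → GA.Occupied D x → ∀ w → GP.Occupied (layered D) (x , w)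
  layered-occupied D {x} (i , Di≡x) w = copIndex (i , w) , (begin
    layered D (copIndex (i , w)) ≡⟨ cong (λ p → D (proj₁ p) , proj₂ p) (cop-copIndex (i , w)) ⟩
    (D i , w)                    ≡⟨ cong (_, w) Di≡x ⟩
    (x , w)                      ∎)
    where open ≡-Reasoning

  layered-step : ∀ D D' → GA.CopStep D D' → GP.CopStep (layered D) (layered D')
  layered-step D D' s c with s (proj₁ (cop c))
  ... | inj₁ stay = inj₁ (cong (_, proj₂ (cop c)) stay)
  ... | inj₂ edge = inj₂ (inj₁ (edge , refl))

  -- The projection to A of a cop-free walk in the product is a cop-free
  -- walk in A: fibre steps are dropped, A-steps avoid the cops of D.
  project-walk : ∀ D {p q} →
    Star (λ x y → E (A □ H) x y × ¬ GP.Occupied (layered D) y) p q →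
    Star (λ x y → E A x y × ¬ GA.Occupied D y) (proj₁ p) (proj₁ q)
  project-walk D ε = ε
  project-walk D (_◅_ {j = _ , w} (inj₁ (edge , refl) , free) rest) =
    (edge , λ occ → free (layered-occupied D occ w)) ◅ project-walk D rest
  project-walk D ((inj₂ (refl , _) , _) ◅ rest) = project-walk D rest

  layered-win : ∀ D x → GA.CopWin D x → ∀ w → GP.CopWin (layered D) (x , w)
  layered-win D x (GA.move D' s (inj₁ caught)) w =
    GP.move (layered D') (layered-step D D' s) (inj₁ (layered-occupied D' caught w))
  layered-win D x (GA.move D' s (inj₂ next)) w =
    GP.move (layered D') (layered-step D D' s) (inj₂ λ where
      (y , w') (start-free , walk) →
        layered-win D' y
          (next y ((λ occ → start-free (layered-occupied D' occ w)) , project-walk D' walk))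
          w')

  copsWin-□ : CopsWin A k → CopsWin (A □ H) (k * N)
  copsWin-□ (C , wins) = layered C , λ where (x , w) → layered-win C x (wins x) w

scale-bound : ∀ {k} k₁ n₁ N → k ≤ k₁ * N → k * n₁ ≤ n₁ * N * k₁
scale-bound {k} k₁ n₁ N k≤ = subst (k * n₁ ≤_) rearrange (*-monoˡ-≤ n₁ k≤)
  where
  open ≡-Reasoning
  rearrange : k₁ * N * n₁ ≡ n₁ * N * k₁
  rearrange = begin
    k₁ * N * n₁   ≡⟨ *-comm (k₁ * N) n₁ ⟩
    n₁ * (k₁ * N) ≡⟨ cong (n₁ *_) (*-comm k₁ N) ⟩
    n₁ * (N * k₁) ≡⟨ *-assoc n₁ N k₁ ⟨
    n₁ * N * k₁   ∎

lemma6p1 : (G₁ : FinGraph) (Gs : List FinGraph) →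
    All Connected (G₁ ∷ Gs) →
    (k₁ k : ℕ) →
    IsCopNumber (toGraph G₁) k₁ →
    IsCopNumber (CartesianProduct (G₁ ∷ Gs)) k →
    k * size G₁ ≤ productSize (G₁ ∷ Gs) * k₁
lemma6p1 G₁ Gs _ k₁ k (k₁-win , _) (_ , k-minimal) =
  scale-bound k₁ (size G₁) N (k-minimal (k₁ * N) product-win)
  where
  N = productSize Gs
  product-win : CopsWin (CartesianProduct (G₁ ∷ Gs)) (k₁ * N)
  product-win = Layered.copsWin-□ (toGraph G₁) (CartesianProduct Gs) k₁ N
                  (productEnumeration Gs) k₁-win
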